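{- Let $G$ be a connected graph and let $w$ be a word representing $G$ such that $w$ contains at least one square. Then there exists a square-free word $w'$ that represents $G$.
   Context: A word $w$ over the alphabet $V$ represents the simple graph $G=(V,E)$ if every letter of $V$ occurs in $w$ and, for all distinct $x,y\in V$, the letters $x$ and $y$ alternate in $w$ (i.e. deleting all other letters from $w$ leaves a word of the form $xyxy\cdots$ or $yxyx\cdots$) if and only if $xy\in E$. A square in a word is a factor of the form $XX$ with $X$ a non-empty word; a word is square-free if it contains no square. -}

module Defs where

open import Data.Nat using (ℕ)
open import Data.Fin using (Fin)
open import Data.Fin.Properties using (_≟_)
open import Data.List using (List; []; _∷_; _++_)
open import Data.List.Membership.Propositional using (_∈_)
open import Data.Product using (_×_; Σ; ∃; ∃-syntax; _,_)
open import Data.Sum using (_⊎_)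
open import Data.Empty using (⊥)
open import Relation.Nullary using (¬_; yes; no)
open import Relation.Binary.PropositionalEquality using (_≡_)
open import Relation.Binary.Construct.Closure.ReflexiveTransitive using (Star)
open import Level using (0ℓ; suc)

record SimpleGraph (n : ℕ) : Set₁ where
  field
    Adj   : Fin n → Fin n → Set
    sym   : ∀ {x y} → Adj x y → Adj y x
    irrefl : ∀ {x} → ¬ Adj x x
open SimpleGraph public

Connected : ∀ {n} → SimpleGraph n → Set
Connected {n} G = ∀ (x y : Fin n) → Star (Adj G) x y

Word : ℕ → Set
Word n = List (Fin n)

restrict : ∀ {n} → Fin n → Fin n → Word n → Word n
restrict x y [] = []
restrict x y (z ∷ w) with z ≟ x | z ≟ y
... | yes _ | _     = z ∷ restrict x y w
... | no _  | yes _ = z ∷ restrict x y w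
... | no _  | no _  = restrict x y w

data AltFrom {n} : Fin n → Fin n → Word n → Set where
  alt-[] : ∀ {x y} → AltFrom x y []
  alt-∷  : ∀ {x y u} → AltFrom y x u → AltFrom x y (x ∷ u)

Alternate : ∀ {n} → Fin n → Fin n → Word n → Set
Alternate x y w = AltFrom x y (restrict x y w) ⊎ AltFrom y x (restrict x y w)

Represents : ∀ {n} → Word n → SimpleGraph n → Set
Represents {n} w G =
  (∀ (x : Fin n) → x ∈ w) ×
  (∀ (x y : Fin n) → ¬ x ≡ y → (Alternate x y w → Adj G x y) × (Adj G x y → Alternate x y w))

HasSquare : ∀ {n} → Word n → Set
HasSquare {n} w = ∃[ u ] ∃[ X ] ∃[ v ] (¬ X ≡ []) × (w ≡ u ++ X ++ X ++ v)

SquareFree : ∀ {n} → Word n → Set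
SquareFree w = ¬ HasSquare w

{-# OPTIONS --safe #-}
-- If xy is an edge then x and y alternate in w = u X X v, and an alternating word of the
-- form X X forces X to contain x and y equally often. Connectivity spreads this along
-- walks, so every letter occurs in X equally often. Then for every pair x, y the
-- restriction of X is balanced, and deleting (or re-inserting) one copy of a balanced
-- alternating block never changes whether x and y alternate: u X v represents G too.
-- Iterating on the strictly shorter word ends at a square-free one.
module Submission where

open import Defs hiding (sym)
open import Data.Nat using (ℕ; suc; _<_; s≤s)
open import Data.Nat.Properties using (suc-injective; 1+n≢0)
open import Data.Nat.Induction using (<-wellFounded)
open import Data.Fin using (Fin)
open import Data.Fin.Properties using (_≟_)
open import Data.List using (List; []; _∷_; _++_; length)
open import Data.List.Properties using (≡-dec; length-++-≤ʳ)
open import Data.List.Membership.Propositional.Properties using (∈-++⁻)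
open import Data.List.Relation.Binary.Subset.Propositional using (_⊆_)
open import Data.List.Relation.Binary.Subset.Propositional.Properties using (xs⊆xs++ys; ++⁺ʳ)
open import Data.Product using (∃-syntax; _×_; _,_; proj₁; proj₂)
open import Data.Sum using (_⊎_; inj₁; inj₂; [_,_]′)
import Data.Sum as Sum
open import Data.Empty using (⊥-elim)
open import Function using (id; _∘_)
open import Function.Bundles using (_⇔_; mk⇔; Equivalence)
open import Induction.WellFounded using (Acc; acc)
open import Relation.Nullary using (Dec; yes; no; ¬?)
open import Relation.Nullary.Decidable using (map′; _×-dec_; _⊎-dec_)
open import Relation.Binary.Definitions using (DecidableEquality)
open import Relation.Binary.PropositionalEquality using (_≡_; _≢_; refl; sym; trans; cong)
import Relation.Binary.Construct.Closure.ReflexiveTransitive as Star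

open Equivalence using (to; from)

module _ {A : Set} where

  split? : {P : List A → List A → Set} → (∀ a b → Dec (P a b)) →
    ∀ w → Dec (∃[ a ] ∃[ b ] (w ≡ a ++ b × P a b))
  split? P? [] = map′
    (λ p → [] , [] , refl , p)
    (λ { ([] , _ , refl , p) → p ; (_ ∷ _ , _ , () , _) })
    (P? [] [])
  split? P? (z ∷ w) = map′
    [ (λ p → [] , z ∷ w , refl , p) , (λ { (a , b , refl , p) → z ∷ a , b , refl , p }) ]′
    (λ { ([] , _ , refl , p) → inj₁ p ; (_ ∷ a , b , refl , p) → inj₂ (a , b , refl , p) })
    (P? [] (z ∷ w) ⊎-dec split? (λ a → P? (z ∷ a)) w)

  prefix? : DecidableEquality A → (X w : List A) → Dec (∃[ v ] w ≡ X ++ v)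
  prefix? _≟_ X = map′
    (λ { (_ , v , refl , refl) → v , refl })
    (λ { (v , refl) → X , v , refl , refl })
    ∘ split? (λ a _ → ≡-dec _≟_ a X)

  ++-square-⊆ : ∀ (u X v : List A) → u ++ X ++ X ++ v ⊆ u ++ X ++ v
  ++-square-⊆ u X v = ++⁺ʳ u (λ x∈ → [ xs⊆xs++ys X v , id ]′ (∈-++⁻ X x∈))

  ++-square-shorter : ∀ (u X v : List A) → X ≢ [] → length (u ++ X ++ v) < length (u ++ X ++ X ++ v)
  ++-square-shorter []      []      v X≢[] = ⊥-elim (X≢[] refl)
  ++-square-shorter []      (x ∷ X) v _    = s≤s (length-++-≤ʳ (x ∷ X ++ v) {X})
  ++-square-shorter (_ ∷ u) X       v X≢[] = s≤s (++-square-shorter u X v X≢[])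

module _ {n : ℕ} where

  count : Fin n → Word n → ℕ
  count x [] = 0
  count x (z ∷ w) with z ≟ x
  ... | yes _ = suc (count x w)
  ... | no  _ = count x w

  count-∷-self : ∀ x (w : Word n) → count x (x ∷ w) ≡ suc (count x w)
  count-∷-self x w with x ≟ x
  ... | yes _   = refl
  ... | no  x≢x = ⊥-elim (x≢x refl)

  count-∷-other : ∀ {x z} (w : Word n) → z ≢ x → count x (z ∷ w) ≡ count x w
  count-∷-other {x} {z} w z≢x with z ≟ x
  ... | yes z≡x = ⊥-elim (z≢x z≡x)
  ... | no  _   = refl

  count-∷-cong : ∀ {x} z {v w : Word n} → count x v ≡ count x w → count x (z ∷ v) ≡ count x (z ∷ w)
  count-∷-cong {x} z eq with z ≟ x
  ... | yes _ = cong suc eq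
  ... | no  _ = eq

  count-restrict : ∀ {x y t} (w : Word n) → t ≡ x ⊎ t ≡ y → count t (restrict x y w) ≡ count t w
  count-restrict [] _ = refl
  count-restrict {x} {y} {t} (z ∷ w) t∈xy with z ≟ x | z ≟ y
  ... | yes _   | _       = count-∷-cong z (count-restrict w t∈xy)
  ... | no  _   | yes _   = count-∷-cong z (count-restrict w t∈xy)
  ... | no  z≢x | no  z≢y = trans (count-restrict w t∈xy) (sym (count-∷-other w z≢t))
    where
    z≢t : z ≢ t
    z≢t z≡t = [ z≢x ∘ trans z≡t , z≢y ∘ trans z≡t ]′ t∈xy

  restrict-++ : ∀ x y (v w : Word n) → restrict x y (v ++ w) ≡ restrict x y v ++ restrict x y w
  restrict-++ x y [] w = refl
  restrict-++ x y (z ∷ v) w with z ≟ x | z ≟ y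
  ... | yes _ | _     = cong (z ∷_) (restrict-++ x y v w)
  ... | no  _ | yes _ = cong (z ∷_) (restrict-++ x y v w)
  ... | no  _ | no  _ = restrict-++ x y v w

  AltFrom-head : ∀ {x y z} {s : Word n} → AltFrom x y (z ∷ s) → z ≡ x
  AltFrom-head (alt-∷ _) = refl

  AltFrom-++⁻ˡ : ∀ {x y} (s : Word n) {t} → AltFrom x y (s ++ t) → AltFrom x y s
  AltFrom-++⁻ˡ []      _         = alt-[]
  AltFrom-++⁻ˡ (_ ∷ s) (alt-∷ p) = alt-∷ (AltFrom-++⁻ˡ s p)

  AltFrom-++⁻ʳ : ∀ {x y} (s : Word n) {t} → AltFrom x y (s ++ t) → AltFrom x y t ⊎ AltFrom y x t
  AltFrom-++⁻ʳ []      p         = inj₁ p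
  AltFrom-++⁻ʳ (_ ∷ s) (alt-∷ p) = Sum.swap (AltFrom-++⁻ʳ s p)

  AltFrom-++⁺ˡ : ∀ {x y} (a : Word n) {s t} →
    (AltFrom x y s → AltFrom x y t) → (AltFrom y x s → AltFrom y x t) →
    AltFrom x y (a ++ s) → AltFrom x y (a ++ t)
  AltFrom-++⁺ˡ []      f g p         = f p
  AltFrom-++⁺ˡ (_ ∷ a) f g (alt-∷ p) = alt-∷ (AltFrom-++⁺ˡ a g f p)

  AltFrom-count : ∀ {x y} {s : Word n} → x ≢ y → AltFrom x y s →
    count x s ≡ count y s ⊎ count x s ≡ suc (count y s)
  AltFrom-count _ alt-[] = inj₁ refl
  AltFrom-count {x} {y} {x ∷ s} x≢y (alt-∷ p)
    rewrite count-∷-self x s | count-∷-other s x≢y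
    with AltFrom-count (x≢y ∘ sym) p
  ... | inj₁ even = inj₂ (cong suc (sym even))
  ... | inj₂ odd  = inj₁ (sym odd)

  AltFrom-balanced-++ : ∀ {x y} {s t : Word n} → x ≢ y → AltFrom x y s → count x s ≡ count y s →
    AltFrom x y (s ++ t) ⇔ AltFrom x y t
  AltFrom-balanced-++ _ alt-[] _ = mk⇔ id id
  AltFrom-balanced-++ {x} {y} x≢y (alt-∷ alt-[]) balanced =
    ⊥-elim (1+n≢0 (trans (sym (count-∷-self x [])) (trans balanced (count-∷-other [] x≢y))))
  AltFrom-balanced-++ {x} {y} {x ∷ y ∷ s} x≢y (alt-∷ (alt-∷ p)) balanced =
    mk⇔ (λ { (alt-∷ (alt-∷ q)) → to rest q }) (λ q → alt-∷ (alt-∷ (from rest q)))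
    where
    rest = AltFrom-balanced-++ x≢y p (suc-injective (trans (sym count-x) (trans balanced count-y)))
      where
      count-x : count x (x ∷ y ∷ s) ≡ suc (count x s)
      count-x = trans (count-∷-self x (y ∷ s)) (cong suc (count-∷-other s (x≢y ∘ sym)))
      count-y : count y (x ∷ y ∷ s) ≡ suc (count y s)
      count-y = trans (count-∷-other (y ∷ s) x≢y) (count-∷-self y s)

  AltFrom-square⇒balanced : ∀ {x y} (s : Word n) {t} → x ≢ y → AltFrom x y (s ++ s ++ t) →
    count x s ≡ count y s
  AltFrom-square⇒balanced [] _ _ = refl
  AltFrom-square⇒balanced {x} {y} (x ∷ s) x≢y (alt-∷ p)
    with AltFrom-count (x≢y ∘ sym) (AltFrom-++⁻ˡ s p)
  ... | inj₁ even = -- then x ∷ s is odd, so its second copy would have to start with y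
    ⊥-elim (x≢y (AltFrom-head (to (AltFrom-balanced-++ (x≢y ∘ sym) (AltFrom-++⁻ˡ s p) even) p)))
  ... | inj₂ odd = trans (count-∷-self x s) (trans (sym odd) (sym (count-∷-other s x≢y)))

  AltFrom-square⇔ : ∀ {x y} (s : Word n) {t} → x ≢ y → count x s ≡ count y s →
    AltFrom x y (s ++ s ++ t) ⇔ AltFrom x y (s ++ t)
  AltFrom-square⇔ s x≢y balanced = mk⇔
    (λ p → to   (AltFrom-balanced-++ x≢y (AltFrom-++⁻ˡ s p) balanced) p)
    (λ p → from (AltFrom-balanced-++ x≢y (AltFrom-++⁻ˡ s p) balanced) p)

  Alternating : Fin n → Fin n → Word n → Set
  Alternating x y s = AltFrom x y s ⊎ AltFrom y x s

  Alternating-++⁻ʳ : ∀ {x y} (a : Word n) {s} → Alternating x y (a ++ s) → Alternating x y s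
  Alternating-++⁻ʳ a = [ AltFrom-++⁻ʳ a , Sum.swap ∘ AltFrom-++⁻ʳ a ]′

  Alternating-square⇒balanced : ∀ {x y} (a s : Word n) {t} → x ≢ y →
    Alternating x y (a ++ s ++ s ++ t) → count x s ≡ count y s
  Alternating-square⇒balanced a s x≢y alt with Alternating-++⁻ʳ a alt
  ... | inj₁ p = AltFrom-square⇒balanced s x≢y p
  ... | inj₂ p = sym (AltFrom-square⇒balanced s (x≢y ∘ sym) p)

  Alternating-square⇔ : ∀ {x y} (a s : Word n) {t} → x ≢ y → count x s ≡ count y s →
    Alternating x y (a ++ s ++ s ++ t) ⇔ Alternating x y (a ++ s ++ t)
  Alternating-square⇔ a s x≢y balanced = mk⇔
    (Sum.map (AltFrom-++⁺ˡ a (to xy)   (to yx))   (AltFrom-++⁺ˡ a (to yx)   (to xy)))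
    (Sum.map (AltFrom-++⁺ˡ a (from xy) (from yx)) (AltFrom-++⁺ˡ a (from yx) (from xy)))
    where
    xy = AltFrom-square⇔ s x≢y balanced
    yx = AltFrom-square⇔ s (x≢y ∘ sym) (sym balanced)

  restrict-balanced : ∀ {x y} (w : Word n) →
    count x (restrict x y w) ≡ count y (restrict x y w) ⇔ count x w ≡ count y w
  restrict-balanced {x} {y} w
    rewrite count-restrict {x} {y} w (inj₁ refl) | count-restrict {x} {y} w (inj₂ refl) = mk⇔ id id

  Alternate-square⇒balanced : ∀ {x y} (u X v : Word n) → x ≢ y →
    Alternate x y (u ++ X ++ X ++ v) → count x X ≡ count y X
  Alternate-square⇒balanced {x} {y} u X v x≢y alt
    rewrite restrict-++ x y u (X ++ X ++ v) | restrict-++ x y X (X ++ v) | restrict-++ x y X v =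
    to (restrict-balanced X) (Alternating-square⇒balanced (restrict x y u) (restrict x y X) x≢y alt)

  Alternate-square⇔ : ∀ {x y} (u X v : Word n) → x ≢ y → count x X ≡ count y X →
    Alternate x y (u ++ X ++ X ++ v) ⇔ Alternate x y (u ++ X ++ v)
  Alternate-square⇔ {x} {y} u X v x≢y balanced
    rewrite restrict-++ x y u (X ++ X ++ v) | restrict-++ x y X (X ++ v) | restrict-++ x y u (X ++ v)
          | restrict-++ x y X v =
    Alternating-square⇔ (restrict x y u) (restrict x y X) x≢y (from (restrict-balanced X) balanced)

  Adj⇒≢ : ∀ (G : SimpleGraph n) {x y} → Adj G x y → x ≢ y
  Adj⇒≢ G xy refl = irrefl G xy

  Represents-square⇒balanced : ∀ (G : SimpleGraph n) (u X v : Word n) → Connected G →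
    Represents (u ++ X ++ X ++ v) G → ∀ x y → count x X ≡ count y X
  Represents-square⇒balanced G u X v connected (_ , represents) x y =
    Star.fold (λ a b → count a X ≡ count b X) (λ ab → trans (edge⇒balanced ab)) refl (connected x y)
    where
    edge⇒balanced : ∀ {a b} → Adj G a b → count a X ≡ count b X
    edge⇒balanced {a} {b} ab =
      Alternate-square⇒balanced u X v (Adj⇒≢ G ab) (proj₂ (represents a b (Adj⇒≢ G ab)) ab)

  Represents-halveSquare : ∀ (G : SimpleGraph n) (u X v : Word n) → Connected G →
    Represents (u ++ X ++ X ++ v) G → Represents (u ++ X ++ v) G
  Represents-halveSquare G u X v connected rep@(occurs , represents) =
    ++-square-⊆ u X v ∘ occurs ,
    λ x y x≢y →
      let square = Alternate-square⇔ u X v x≢y (Represents-square⇒balanced G u X v connected rep x y)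
      in  proj₁ (represents x y x≢y) ∘ from square , to square ∘ proj₂ (represents x y x≢y)

  hasSquare? : (w : Word n) → Dec (HasSquare w)
  hasSquare? w = map′
    (λ { (u , _ , refl , X , _ , refl , X≢[] , v , refl) → u , X , v , X≢[] , refl })
    (λ { (u , X , v , X≢[] , refl) → u , X ++ X ++ v , refl , X , X ++ v , refl , X≢[] , v , refl })
    (split? (λ _ → split? (λ X r → ¬? (≡-dec _≟_ X []) ×-dec prefix? _≟_ X r)) w)

  squareFree-reduct : ∀ (G : SimpleGraph n) → Connected G → (w : Word n) → Acc _<_ (length w) →
    Represents w G → ∃[ w′ ] (SquareFree w′ × Represents w′ G)
  squareFree-reduct G connected w (acc shorter) rep with hasSquare? w
  ... | no  squareFree = w , squareFree , rep
  ... | yes (u , X , v , X≢[] , refl) =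
    squareFree-reduct G connected (u ++ X ++ v) (shorter (++-square-shorter u X v X≢[]))
      (Represents-halveSquare G u X v connected rep)

mainTheorem3 : ∀ (n : ℕ) (G : SimpleGraph n) (w : Word n) →
    Connected G → Represents w G → HasSquare w →
    ∃[ w′ ] (SquareFree w′ × Represents w′ G)
mainTheorem3 n G w connected represents _ =
  squareFree-reduct G connected w (<-wellFounded (length w)) represents
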